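{- For every integer $n\ge1$, $$\nu_2\Bigl(\sum_{j=1}^n\frac1{2j-1}\Bigr)=2\nu_2(n).$$
   Context: $\nu_2$ denotes the exponent of $2$ in a nonzero rational number. -}

module Defs where

open import Data.Nat as ℕ using (ℕ; zero; suc)
open import Data.Nat.DivMod using (_%_; _/_)
open import Data.Integer as ℤ using (ℤ; +_)
open import Data.Rational as ℚ using (ℚ; 0ℚ)

-- 2-adic valuation of a natural number, computed with fuel.
-- ν₂ℕ n = largest k with 2^k ∣ n, for n ≥ 1 (fuel n suffices).
-- (Junk value 0 at n = 0.)
ν₂ℕ-fuel : ℕ → ℕ → ℕ
ν₂ℕ-fuel zero    n = 0
ν₂ℕ-fuel (suc f) zero = 0
ν₂ℕ-fuel (suc f) (suc m) with (suc m) % 2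
... | zero  = suc (ν₂ℕ-fuel f (suc m / 2))
... | suc _ = 0

ν₂ℕ : ℕ → ℕ
ν₂ℕ n = ν₂ℕ-fuel n n

-- 2-adic valuation of a rational q = a/b (lowest terms, b > 0):
-- ν₂(q) = ν₂(|a|) - ν₂(b).  Only meaningful for q ≠ 0.
ν₂ : ℚ → ℤ
ν₂ q = (+ ν₂ℕ ℤ.∣ ℚ.numerator q ∣) ℤ.- (+ ν₂ℕ (ℚ.denominatorℕ q))

S : ℕ → ℚ
S zero    = 0ℚ
S (suc n) = S n ℚ.+ ((+ 1) ℚ./ suc (2 ℕ.* n))

-- Write n = 2^k m with m odd and compute in ℤ₍₂₎, the rationals with odd
-- denominator.  Pairing j with n-1-j gives S n = n T n, where
-- T n = Σ 1/((2j+1)(2n-2j-1)), and each term of T n is -1/(2j+1)² modulo 2n.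
-- Odd numbers congruent modulo 2^(s+1) have inverse squares congruent modulo 2^(s+2),
-- so by doubling, 2^k consecutive terms 1/(2j+1)² sum to 2^k modulo 2^(k+1).
-- Hence T n ≡ -2^k m ≡ 2^k modulo 2^(k+1), so S n = 2^k (m T n) ≡ 2^(2k) modulo
-- 2^(2k+1), which pins ν₂ (S n) = 2k.

module Submission where

open import Data.Empty using (⊥-elim)
open import Data.Integer as ℤ using (ℤ; +_; ∣_∣)
import Data.Integer.Divisibility.Signed as ℤ∣
import Data.Integer.Properties as ℤ
import Data.Integer.Tactic.RingSolver as ℤ-Solver
open import Data.Nat as ℕ using (ℕ; zero; suc; _^_; _<_; _%_; _/_; NonZero; s≤s; z≤n)
open import Data.Nat.DivMod using (m≡m%n+[m/n]*n; m/n<m; m%n<n)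
open import Data.Nat.Divisibility using (_∣_; _∤_; _∣0; ∣m+n∣m⇒∣n; m∣m*n; ∣1⇒≡1; n∣m⇒m%n≡0; m%n≡0⇒n∣m)
open import Data.Nat.Primality using (euclidsLemma; prime[2])
import Data.Nat.Properties as ℕ
import Data.Nat.Tactic.RingSolver as ℕ-Solver
open import Data.Product using (∃-syntax; _×_; _,_)
open import Data.Rational as ℚ using (ℚ; _+_; _*_; _-_; -_; 0ℚ; 1ℚ; ½)
open import Data.Rational.Literals using (fromℤ)
import Data.Rational.Properties as ℚ
import Data.Rational.Unnormalised as ℚᵘ
import Data.Rational.Unnormalised.Properties as ℚᵘ
open import Data.Sum using ([_,_]′)
open import Level using (0ℓ)
open import Relation.Binary.Bundles using (Setoid)
open import Relation.Binary.PropositionalEquality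
import Relation.Binary.Reasoning.Setoid as SetoidReasoning
open import Relation.Nullary.Decidable.Core using (dec⇒maybe)
open import Tactic.RingSolver using (solve-∀)
import Tactic.RingSolver.Core.AlmostCommutativeRing as ACR

open import Defs

ℚ-ring : ACR.AlmostCommutativeRing 0ℓ 0ℓ
ℚ-ring = ACR.fromCommutativeRing ℚ.+-*-commutativeRing (λ x → dec⇒maybe (0ℚ ℚ.≟ x))

-- Odd numbers and the 2-adic valuation on ℕ

2∤1+2* : ∀ j → 2 ∤ suc (2 ℕ.* j)
2∤1+2* j 2∣1+2j with ∣1⇒≡1 (∣m+n∣m⇒∣n (subst (2 ∣_) (ℕ.+-comm 1 (2 ℕ.* j)) 2∣1+2j) (m∣m*n j))
... | ()

2∤-* : ∀ {m n} → 2 ∤ m → 2 ∤ n → 2 ∤ m ℕ.* n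
2∤-* 2∤m 2∤n 2∣mn = [ 2∤m , 2∤n ]′ (euclidsLemma _ _ prime[2] 2∣mn)

2∤⇒nonZero : ∀ {o} → 2 ∤ o → NonZero o
2∤⇒nonZero {zero}  2∤0 = ⊥-elim (2∤0 (2 ∣0))
2∤⇒nonZero {suc o} _   = _

2∤⇒1+2* : ∀ {m} → 2 ∤ m → ∃[ t ] m ≡ suc (2 ℕ.* t)
2∤⇒1+2* {m} 2∤m with m % 2 in parity | m%n<n m 2
... | 0           | _             = ⊥-elim (2∤m (m%n≡0⇒n∣m m 2 parity))
... | 1           | _             = m / 2 , (begin
  m                       ≡⟨ m≡m%n+[m/n]*n m 2 ⟩
  m % 2 ℕ.+ m / 2 ℕ.* 2   ≡⟨ cong (ℕ._+ m / 2 ℕ.* 2) parity ⟩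
  suc (m / 2 ℕ.* 2)       ≡⟨ cong suc (ℕ.*-comm (m / 2) 2) ⟩
  suc (2 ℕ.* (m / 2))     ∎)
  where open ≡-Reasoning
... | suc (suc _) | s≤s (s≤s ())

2^*odd-nonZero : ∀ k {o} → 2 ∤ o → NonZero (2 ^ k ℕ.* o)
2^*odd-nonZero k {o} 2∤o = ℕ.m*n≢0 (2 ^ k) o {{ℕ.m^n≢0 2 k}} {{2∤⇒nonZero 2∤o}}

ν₂ℕ-fuel-decomposition : ∀ f n .{{_ : NonZero n}} → n ℕ.≤ f → ∃[ o ] 2 ∤ o × n ≡ 2 ^ ν₂ℕ-fuel f n ℕ.* o
ν₂ℕ-fuel-decomposition zero    (suc m) ()
ν₂ℕ-fuel-decomposition (suc f) (suc m) (s≤s m≤f) with suc m % 2 in parity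
... | suc r = suc m , 2∤n , sym (ℕ.*-identityˡ (suc m))
  where
  2∤n : 2 ∤ suc m
  2∤n 2∣n = ℕ.1+n≢0 (trans (sym parity) (n∣m⇒m%n≡0 (suc m) 2 2∣n))
... | zero = double (ν₂ℕ-fuel-decomposition f h {{h≢0}} h≤f)
  where
  open ≡-Reasoning
  h : ℕ
  h = suc m / 2
  n≡h*2 : suc m ≡ h ℕ.* 2
  n≡h*2 = trans (m≡m%n+[m/n]*n (suc m) 2) (cong (ℕ._+ h ℕ.* 2) parity)
  h≢0 : NonZero h
  h≢0 = ℕ.≢-nonZero λ h≡0 → ℕ.1+n≢0 (trans n≡h*2 (cong (ℕ._* 2) h≡0))
  h≤f : h ℕ.≤ f
  h≤f = ℕ.≤-trans (ℕ.s≤s⁻¹ (m/n<m (suc m) 2 (s≤s (s≤s z≤n)))) m≤f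
  double : ∃[ o ] 2 ∤ o × h ≡ 2 ^ ν₂ℕ-fuel f h ℕ.* o → ∃[ o ] 2 ∤ o × suc m ≡ 2 ^ suc (ν₂ℕ-fuel f h) ℕ.* o
  double (o , 2∤o , h≡) = o , 2∤o , (begin
    suc m                            ≡⟨ n≡h*2 ⟩
    h ℕ.* 2                          ≡⟨ ℕ.*-comm h 2 ⟩
    2 ℕ.* h                          ≡⟨ cong (2 ℕ.*_) h≡ ⟩
    2 ℕ.* (2 ^ ν₂ℕ-fuel f h ℕ.* o)   ≡⟨ ℕ.*-assoc 2 (2 ^ ν₂ℕ-fuel f h) o ⟨
    2 ^ suc (ν₂ℕ-fuel f h) ℕ.* o     ∎)

ν₂ℕ-decomposition : ∀ n .{{_ : NonZero n}} → ∃[ o ] 2 ∤ o × n ≡ 2 ^ ν₂ℕ n ℕ.* o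
ν₂ℕ-decomposition n = ν₂ℕ-fuel-decomposition n n ℕ.≤-refl

2^*odd-injective : ∀ k k′ {o o′} → 2 ∤ o → 2 ∤ o′ → 2 ^ k ℕ.* o ≡ 2 ^ k′ ℕ.* o′ → k ≡ k′
2^*odd-injective zero    zero     _   _    _  = refl
2^*odd-injective zero    (suc k′) {o} {o′} 2∤o _ eq = ⊥-elim (2∤o (subst (2 ∣_) (sym o≡2*_) (m∣m*n (2 ^ k′ ℕ.* o′))))
  where
  o≡2*_ : o ≡ 2 ℕ.* (2 ^ k′ ℕ.* o′)
  o≡2*_ = trans (sym (ℕ.*-identityˡ o)) (trans eq (ℕ.*-assoc 2 (2 ^ k′) o′))
2^*odd-injective (suc k) zero     2∤o 2∤o′ eq = sym (2^*odd-injective zero (suc k) 2∤o′ 2∤o (sym eq))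
2^*odd-injective (suc k) (suc k′) {o} {o′} 2∤o 2∤o′ eq = cong suc (2^*odd-injective k k′ 2∤o 2∤o′
  (ℕ.*-cancelˡ-≡ _ _ 2 (trans (sym (ℕ.*-assoc 2 (2 ^ k) o)) (trans eq (ℕ.*-assoc 2 (2 ^ k′) o′)))))

ν₂ℕ-2^*odd : ∀ k {o} → 2 ∤ o → ν₂ℕ (2 ^ k ℕ.* o) ≡ k
ν₂ℕ-2^*odd k {o} 2∤o with ν₂ℕ-decomposition (2 ^ k ℕ.* o) {{2^*odd-nonZero k 2∤o}}
... | o′ , 2∤o′ , eq = 2^*odd-injective _ k 2∤o′ 2∤o (sym eq)

ν₂ℕ-odd : ∀ {o} → 2 ∤ o → ν₂ℕ o ≡ 0
ν₂ℕ-odd {o} 2∤o = trans (cong ν₂ℕ (sym (ℕ.*-identityˡ o))) (ν₂ℕ-2^*odd 0 2∤o)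

ν₂ℕ-* : ∀ m n .{{_ : NonZero m}} .{{_ : NonZero n}} → ν₂ℕ (m ℕ.* n) ≡ ν₂ℕ m ℕ.+ ν₂ℕ n
ν₂ℕ-* m n with ν₂ℕ-decomposition m | ν₂ℕ-decomposition n
... | o , 2∤o , m≡ | o′ , 2∤o′ , n≡ = begin
  ν₂ℕ (m ℕ.* n)                               ≡⟨ cong ν₂ℕ (cong₂ ℕ._*_ m≡ n≡) ⟩
  ν₂ℕ (2 ^ a ℕ.* o ℕ.* (2 ^ b ℕ.* o′))       ≡⟨ cong ν₂ℕ (regroup (2 ^ a) (2 ^ b) o o′) ⟩
  ν₂ℕ (2 ^ a ℕ.* 2 ^ b ℕ.* (o ℕ.* o′))       ≡⟨ cong (λ p → ν₂ℕ (p ℕ.* (o ℕ.* o′))) (ℕ.^-distribˡ-+-* 2 a b) ⟨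
  ν₂ℕ (2 ^ (a ℕ.+ b) ℕ.* (o ℕ.* o′))         ≡⟨ ν₂ℕ-2^*odd (a ℕ.+ b) (2∤-* 2∤o 2∤o′) ⟩
  a ℕ.+ b                                     ∎
  where
  open ≡-Reasoning
  a b : ℕ
  a = ν₂ℕ m
  b = ν₂ℕ n
  regroup : ∀ a b c d → a ℕ.* c ℕ.* (b ℕ.* d) ≡ a ℕ.* b ℕ.* (c ℕ.* d)
  regroup = ℕ-Solver.solve-∀

a*d≡2^K*v*b⇒ν₂a≡K+ν₂b : ∀ K {a d v b} .{{_ : NonZero b}} → 2 ∤ d → 2 ∤ v →
                         a ℕ.* d ≡ 2 ^ K ℕ.* v ℕ.* b → ν₂ℕ a ≡ K ℕ.+ ν₂ℕ b
a*d≡2^K*v*b⇒ν₂a≡K+ν₂b K {a} {d} {v} {b} 2∤d 2∤v eq = begin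
  ν₂ℕ a                         ≡⟨ ℕ.+-identityʳ (ν₂ℕ a) ⟨
  ν₂ℕ a ℕ.+ 0                   ≡⟨ cong (ν₂ℕ a ℕ.+_) (ν₂ℕ-odd 2∤d) ⟨
  ν₂ℕ a ℕ.+ ν₂ℕ d               ≡⟨ ν₂ℕ-* a d ⟨
  ν₂ℕ (a ℕ.* d)                 ≡⟨ cong ν₂ℕ eq ⟩
  ν₂ℕ (2 ^ K ℕ.* v ℕ.* b)       ≡⟨ ν₂ℕ-* (2 ^ K ℕ.* v) b ⟩
  ν₂ℕ (2 ^ K ℕ.* v) ℕ.+ ν₂ℕ b   ≡⟨ cong (ℕ._+ ν₂ℕ b) (ν₂ℕ-2^*odd K 2∤v) ⟩
  K ℕ.+ ν₂ℕ b                   ∎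
  where
  open ≡-Reasoning
  instance
    d≢0 : NonZero d
    d≢0 = 2∤⇒nonZero 2∤d
    2^K*v≢0 : NonZero (2 ^ K ℕ.* v)
    2^K*v≢0 = 2^*odd-nonZero K 2∤v
    a≢0 : NonZero a
    a≢0 = ℕ.≢-nonZero λ a≡0 → ℕ.≢-nonZero⁻¹ (2 ^ K ℕ.* v ℕ.* b) {{ℕ.m*n≢0 (2 ^ K ℕ.* v) b}}
      (trans (sym eq) (cong (ℕ._* d) a≡0))

-- The 2-adic valuation on ℚ

fromℤ-homo-+ : ∀ a b → fromℤ (a ℤ.+ b) ≡ fromℤ a + fromℤ b
fromℤ-homo-+ a b = ℚ.toℚᵘ-injective (ℚᵘ.≃-sym
  (ℚᵘ.≃-trans (ℚ.toℚᵘ-homo-+ (fromℤ a) (fromℤ b)) (ℚᵘ.*≡* (identity a b))))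
  where
  identity : ∀ a b → (a ℤ.* ℤ.1ℤ ℤ.+ b ℤ.* ℤ.1ℤ) ℤ.* ℤ.1ℤ ≡ (a ℤ.+ b) ℤ.* (ℤ.1ℤ ℤ.* ℤ.1ℤ)
  identity = ℤ-Solver.solve-∀

fromℤ-homo-* : ∀ a b → fromℤ (a ℤ.* b) ≡ fromℤ a * fromℤ b
fromℤ-homo-* a b = ℚ.toℚᵘ-injective (ℚᵘ.≃-sym (ℚ.toℚᵘ-homo-* (fromℤ a) (fromℤ b)))

fromℤ-homo‿- : ∀ a → fromℤ (ℤ.- a) ≡ - fromℤ a
fromℤ-homo‿- a = ℚ.toℚᵘ-injective (ℚᵘ.≃-sym (ℚ.toℚᵘ-homo‿- (fromℤ a)))

fromℕ : ℕ → ℚ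
fromℕ n = fromℤ (+ n)

fromℕ-homo-+ : ∀ m n → fromℕ (m ℕ.+ n) ≡ fromℕ m + fromℕ n
fromℕ-homo-+ m n = trans (cong fromℤ (ℤ.pos-+ m n)) (fromℤ-homo-+ (+ m) (+ n))

fromℕ-homo-* : ∀ m n → fromℕ (m ℕ.* n) ≡ fromℕ m * fromℕ n
fromℕ-homo-* m n = trans (cong fromℤ (ℤ.pos-* m n)) (fromℤ-homo-* (+ m) (+ n))

x*d≡w⇒↥x*d≡w*↧x : ∀ x d w → x * fromℕ d ≡ fromℤ w → ℚ.numerator x ℤ.* + d ≡ w ℤ.* ℚ.denominator x
x*d≡w⇒↥x*d≡w*↧x x@record{} d w eq with ℚᵘ.≃-trans (ℚᵘ.≃-sym (ℚ.toℚᵘ-homo-* x (fromℕ d))) (ℚ.toℚᵘ-cong eq)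
... | ℚᵘ.*≡* cross = begin
  ℚ.numerator x ℤ.* + d                   ≡⟨ ℤ.*-identityʳ (ℚ.numerator x ℤ.* + d) ⟨
  ℚ.numerator x ℤ.* + d ℤ.* + 1           ≡⟨ cross ⟩
  w ℤ.* + (ℚ.denominatorℕ x ℕ.* 1)        ≡⟨ cong (λ k → w ℤ.* + k) (ℕ.*-identityʳ (ℚ.denominatorℕ x)) ⟩
  w ℤ.* ℚ.denominator x                   ∎
  where open ≡-Reasoning

x*d≡2^K*v⇒ν₂x≡K : ∀ K {x d v} → 2 ∤ d → 2 ∤ ∣ v ∣ →
                   x * fromℕ d ≡ fromℤ (+ (2 ^ K) ℤ.* v) → ν₂ x ≡ + K
x*d≡2^K*v⇒ν₂x≡K K {x} {d} {v} 2∤d 2∤v eq = begin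
  + ν₂ℕ ∣ num ∣ ℤ.- + ν₂ℕ den            ≡⟨ cong (λ a → + a ℤ.- + ν₂ℕ den) ν₂ℕ∣num∣≡ ⟩
  + (K ℕ.+ ν₂ℕ den) ℤ.- + ν₂ℕ den        ≡⟨ cong (ℤ._- + ν₂ℕ den) (ℤ.pos-+ K (ν₂ℕ den)) ⟩
  + K ℤ.+ + ν₂ℕ den ℤ.- + ν₂ℕ den        ≡⟨ cancel (+ K) (+ ν₂ℕ den) ⟩
  + K                                    ∎
  where
  open ≡-Reasoning
  num : ℤ
  num = ℚ.numerator x
  den : ℕ
  den = ℚ.denominatorℕ x
  ∣num∣*d≡ : ∣ num ∣ ℕ.* d ≡ 2 ^ K ℕ.* ∣ v ∣ ℕ.* den
  ∣num∣*d≡ = begin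
    ∣ num ∣ ℕ.* d                   ≡⟨ ℤ.abs-* num (+ d) ⟨
    ∣ num ℤ.* + d ∣                 ≡⟨ cong ∣_∣ (x*d≡w⇒↥x*d≡w*↧x x d (+ (2 ^ K) ℤ.* v) eq) ⟩
    ∣ + (2 ^ K) ℤ.* v ℤ.* + den ∣   ≡⟨ ℤ.abs-* (+ (2 ^ K) ℤ.* v) (+ den) ⟩
    ∣ + (2 ^ K) ℤ.* v ∣ ℕ.* den     ≡⟨ cong (ℕ._* den) (ℤ.abs-* (+ (2 ^ K)) v) ⟩
    2 ^ K ℕ.* ∣ v ∣ ℕ.* den         ∎
  ν₂ℕ∣num∣≡ : ν₂ℕ ∣ num ∣ ≡ K ℕ.+ ν₂ℕ den
  ν₂ℕ∣num∣≡ = a*d≡2^K*v*b⇒ν₂a≡K+ν₂b K {∣ num ∣} {d} {∣ v ∣} {den} 2∤d 2∤v ∣num∣*d≡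
  cancel : ∀ a b → a ℤ.+ b ℤ.- b ≡ a
  cancel = ℤ-Solver.solve-∀

-- ℤ₍₂₎ and congruence modulo powers of 2

1/odd : ℕ → ℚ
1/odd j = + 1 ℚ./ suc (2 ℕ.* j)

1/odd-inverse : ∀ j → 1/odd j * fromℕ (suc (2 ℕ.* j)) ≡ 1ℚ
1/odd-inverse j = ℚ.toℚᵘ-injective (ℚᵘ.≃-trans (ℚ.toℚᵘ-homo-* (1/odd j) (fromℕ u))
  (ℚᵘ.≃-trans (ℚᵘ.*-congʳ (ℚ.toℚᵘ-fromℚᵘ (ℚᵘ.mkℚᵘ (+ 1) (2 ℕ.* j)))) (ℚᵘ.*≡* (identity (+ u)))))
  where
  u : ℕ
  u = suc (2 ℕ.* j)
  identity : ∀ x → (ℤ.1ℤ ℤ.* x) ℤ.* ℤ.1ℤ ≡ ℤ.1ℤ ℤ.* (x ℤ.* ℤ.1ℤ)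
  identity = ℤ-Solver.solve-∀

record Integral₂ (x : ℚ) : Set where
  constructor integral
  field
    den     : ℕ
    num     : ℤ
    den-odd : 2 ∤ den
    eq      : x * fromℕ den ≡ fromℤ num

Integral₂-fromℤ : ∀ a → Integral₂ (fromℤ a)
Integral₂-fromℤ a = integral 1 a (2∤1+2* 0) (ℚ.*-identityʳ (fromℤ a))

Integral₂-+ : ∀ {x y} → Integral₂ x → Integral₂ y → Integral₂ (x + y)
Integral₂-+ {x} {y} (integral d a 2∤d xd≡a) (integral e b 2∤e ye≡b) =
  integral (d ℕ.* e) (a ℤ.* + e ℤ.+ b ℤ.* + d) (2∤-* 2∤d 2∤e) (begin
    (x + y) * fromℕ (d ℕ.* e)                      ≡⟨ cong ((x + y) *_) (fromℕ-homo-* d e) ⟩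
    (x + y) * (fromℕ d * fromℕ e)                  ≡⟨ distrib x y (fromℕ d) (fromℕ e) ⟩
    x * fromℕ d * fromℕ e + y * fromℕ e * fromℕ d  ≡⟨ cong₂ (λ u v → u * fromℕ e + v * fromℕ d) xd≡a ye≡b ⟩
    fromℤ a * fromℕ e + fromℤ b * fromℕ d          ≡⟨ cong₂ _+_ (fromℤ-homo-* a (+ e)) (fromℤ-homo-* b (+ d)) ⟨
    fromℤ (a ℤ.* + e) + fromℤ (b ℤ.* + d)          ≡⟨ fromℤ-homo-+ (a ℤ.* + e) (b ℤ.* + d) ⟨
    fromℤ (a ℤ.* + e ℤ.+ b ℤ.* + d)                ∎)
  where
  open ≡-Reasoning
  distrib : ∀ x y d e → (x + y) * (d * e) ≡ x * d * e + y * e * d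
  distrib = solve-∀ ℚ-ring

Integral₂-* : ∀ {x y} → Integral₂ x → Integral₂ y → Integral₂ (x * y)
Integral₂-* {x} {y} (integral d a 2∤d xd≡a) (integral e b 2∤e ye≡b) =
  integral (d ℕ.* e) (a ℤ.* b) (2∤-* 2∤d 2∤e) (begin
    x * y * fromℕ (d ℕ.* e)          ≡⟨ cong (x * y *_) (fromℕ-homo-* d e) ⟩
    x * y * (fromℕ d * fromℕ e)      ≡⟨ regroup x y (fromℕ d) (fromℕ e) ⟩
    x * fromℕ d * (y * fromℕ e)      ≡⟨ cong₂ _*_ xd≡a ye≡b ⟩
    fromℤ a * fromℤ b                ≡⟨ fromℤ-homo-* a b ⟨
    fromℤ (a ℤ.* b)                  ∎)
  where
  open ≡-Reasoning
  regroup : ∀ x y d e → x * y * (d * e) ≡ x * d * (y * e)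
  regroup = solve-∀ ℚ-ring

Integral₂-neg : ∀ {x} → Integral₂ x → Integral₂ (- x)
Integral₂-neg {x} (integral d a 2∤d xd≡a) = integral d (ℤ.- a) 2∤d (begin
  - x * fromℕ d    ≡⟨ ℚ.neg-distribˡ-* x (fromℕ d) ⟨
  - (x * fromℕ d)  ≡⟨ cong -_ xd≡a ⟩
  - fromℤ a        ≡⟨ fromℤ-homo‿- a ⟨
  fromℤ (ℤ.- a)    ∎)
  where open ≡-Reasoning

Integral₂-1/odd : ∀ j → Integral₂ (1/odd j)
Integral₂-1/odd j = integral (suc (2 ℕ.* j)) (+ 1) (2∤1+2* j) (1/odd-inverse j)

infix 4 _≡_[mod2^_]

record _≡_[mod2^_] (x y : ℚ) (r : ℕ) : Set where
  constructor congruent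
  field
    quotient : ℚ
    quotient-integral : Integral₂ quotient
    difference : x - y ≡ fromℕ (2 ^ r) * quotient

module _ {r : ℕ} where

  ≡mod-refl : ∀ {x} → x ≡ x [mod2^ r ]
  ≡mod-refl {x} = congruent 0ℚ (Integral₂-fromℤ (+ 0)) (cancel x (fromℕ (2 ^ r)))
    where
    cancel : ∀ x p → x - x ≡ p * 0ℚ
    cancel = solve-∀ ℚ-ring

  ≡mod-sym : ∀ {x y} → x ≡ y [mod2^ r ] → y ≡ x [mod2^ r ]
  ≡mod-sym {x} {y} (congruent z z∈ eq) = congruent (- z) (Integral₂-neg z∈) (begin
    y - x                   ≡⟨ flip x y ⟩
    - (x - y)               ≡⟨ cong -_ eq ⟩
    - (fromℕ (2 ^ r) * z)   ≡⟨ ℚ.neg-distribʳ-* (fromℕ (2 ^ r)) z ⟩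
    fromℕ (2 ^ r) * - z     ∎)
    where
    open ≡-Reasoning
    flip : ∀ x y → y - x ≡ - (x - y)
    flip = solve-∀ ℚ-ring

  ≡mod-trans : ∀ {x y w} → x ≡ y [mod2^ r ] → y ≡ w [mod2^ r ] → x ≡ w [mod2^ r ]
  ≡mod-trans {x} {y} {w} (congruent z z∈ eq) (congruent z′ z′∈ eq′) =
    congruent (z + z′) (Integral₂-+ z∈ z′∈) (begin
    x - w                                    ≡⟨ telescope x y w ⟩
    (x - y) + (y - w)                        ≡⟨ cong₂ _+_ eq eq′ ⟩
    fromℕ (2 ^ r) * z + fromℕ (2 ^ r) * z′   ≡⟨ ℚ.*-distribˡ-+ (fromℕ (2 ^ r)) z z′ ⟨
    fromℕ (2 ^ r) * (z + z′)                 ∎)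
    where
    open ≡-Reasoning
    telescope : ∀ x y w → x - w ≡ (x - y) + (y - w)
    telescope = solve-∀ ℚ-ring

  ≡mod-+ : ∀ {x y x′ y′} → x ≡ y [mod2^ r ] → x′ ≡ y′ [mod2^ r ] → x + x′ ≡ y + y′ [mod2^ r ]
  ≡mod-+ {x} {y} {x′} {y′} (congruent z z∈ eq) (congruent z′ z′∈ eq′) =
    congruent (z + z′) (Integral₂-+ z∈ z′∈) (begin
    (x + x′) - (y + y′)                      ≡⟨ interchange x x′ y y′ ⟩
    (x - y) + (x′ - y′)                      ≡⟨ cong₂ _+_ eq eq′ ⟩
    fromℕ (2 ^ r) * z + fromℕ (2 ^ r) * z′   ≡⟨ ℚ.*-distribˡ-+ (fromℕ (2 ^ r)) z z′ ⟨
    fromℕ (2 ^ r) * (z + z′)                 ∎)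
    where
    open ≡-Reasoning
    interchange : ∀ x x′ y y′ → (x + x′) - (y + y′) ≡ (x - y) + (x′ - y′)
    interchange = solve-∀ ℚ-ring

  ≡mod-neg : ∀ {x y} → x ≡ y [mod2^ r ] → - x ≡ - y [mod2^ r ]
  ≡mod-neg {x} {y} (congruent z z∈ eq) = congruent (- z) (Integral₂-neg z∈) (begin
    - x - - y               ≡⟨ negate x y ⟩
    - (x - y)               ≡⟨ cong -_ eq ⟩
    - (fromℕ (2 ^ r) * z)   ≡⟨ ℚ.neg-distribʳ-* (fromℕ (2 ^ r)) z ⟩
    fromℕ (2 ^ r) * - z     ∎)
    where
    open ≡-Reasoning
    negate : ∀ x y → - x - - y ≡ - (x - y)
    negate = solve-∀ ℚ-ring

  ≡mod-*ˡ : ∀ {c x y} → Integral₂ c → x ≡ y [mod2^ r ] → c * x ≡ c * y [mod2^ r ]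
  ≡mod-*ˡ {c} {x} {y} c∈ (congruent z z∈ eq) = congruent (c * z) (Integral₂-* c∈ z∈) (begin
    c * x - c * y           ≡⟨ factor c x y ⟩
    c * (x - y)             ≡⟨ cong (c *_) eq ⟩
    c * (fromℕ (2 ^ r) * z) ≡⟨ swap c (fromℕ (2 ^ r)) z ⟩
    fromℕ (2 ^ r) * (c * z) ∎)
    where
    open ≡-Reasoning
    factor : ∀ c x y → c * x - c * y ≡ c * (x - y)
    factor = solve-∀ ℚ-ring
    swap : ∀ c p z → c * (p * z) ≡ p * (c * z)
    swap = solve-∀ ℚ-ring

  ≡mod-2^*ˡ : ∀ s {x y} → x ≡ y [mod2^ r ] → fromℕ (2 ^ s) * x ≡ fromℕ (2 ^ s) * y [mod2^ s ℕ.+ r ]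
  ≡mod-2^*ˡ s {x} {y} (congruent z z∈ eq) = congruent z z∈ (begin
    fromℕ (2 ^ s) * x - fromℕ (2 ^ s) * y   ≡⟨ factor (fromℕ (2 ^ s)) x y ⟩
    fromℕ (2 ^ s) * (x - y)                 ≡⟨ cong (fromℕ (2 ^ s) *_) eq ⟩
    fromℕ (2 ^ s) * (fromℕ (2 ^ r) * z)     ≡⟨ ℚ.*-assoc (fromℕ (2 ^ s)) (fromℕ (2 ^ r)) z ⟨
    fromℕ (2 ^ s) * fromℕ (2 ^ r) * z       ≡⟨ cong (_* z) (fromℕ-homo-* (2 ^ s) (2 ^ r)) ⟨
    fromℕ (2 ^ s ℕ.* 2 ^ r) * z             ≡⟨ cong (λ p → fromℕ p * z) (ℕ.^-distribˡ-+-* 2 s r) ⟨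
    fromℕ (2 ^ (s ℕ.+ r)) * z               ∎)
    where
    open ≡-Reasoning
    factor : ∀ c x y → c * x - c * y ≡ c * (x - y)
    factor = solve-∀ ℚ-ring

≡mod-weaken : ∀ {r x y} → x ≡ y [mod2^ suc r ] → x ≡ y [mod2^ r ]
≡mod-weaken {r} {x} {y} (congruent z z∈ eq) = congruent (fromℕ 2 * z) (Integral₂-* (Integral₂-fromℤ (+ 2)) z∈) (begin
  x - y                         ≡⟨ eq ⟩
  fromℕ (2 ℕ.* 2 ^ r) * z       ≡⟨ cong (_* z) (fromℕ-homo-* 2 (2 ^ r)) ⟩
  fromℕ 2 * fromℕ (2 ^ r) * z   ≡⟨ swap (fromℕ 2) (fromℕ (2 ^ r)) z ⟩
  fromℕ (2 ^ r) * (fromℕ 2 * z) ∎)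
  where
  open ≡-Reasoning
  swap : ∀ a b z → a * b * z ≡ b * (a * z)
  swap = solve-∀ ℚ-ring

≡mod-setoid : ℕ → Setoid 0ℓ 0ℓ
≡mod-setoid r = record
  { Carrier = ℚ
  ; _≈_ = _≡_[mod2^ r ]
  ; isEquivalence = record { refl = ≡mod-refl ; sym = ≡mod-sym ; trans = ≡mod-trans }
  }

module ≡mod-Reasoning (r : ℕ) = SetoidReasoning (≡mod-setoid r)

x≡2^K⇒ν₂x≡K : ∀ K {x} → x ≡ fromℕ (2 ^ K) [mod2^ suc K ] → ν₂ x ≡ + K
x≡2^K⇒ν₂x≡K K {x} (congruent z (integral d a 2∤d zd≡a) x-P≡) = x*d≡2^K*v⇒ν₂x≡K K {x} 2∤d 2∤v (begin
  x * D                                   ≡⟨ split x P D ⟩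
  (x - P) * D + P * D                     ≡⟨ cong (λ y → y * D + P * D) x-P≡ ⟩
  fromℕ (2 ^ suc K) * z * D + P * D       ≡⟨ cong (λ y → y * z * D + P * D) (fromℕ-homo-* 2 (2 ^ K)) ⟩
  (1ℚ + 1ℚ) * P * z * D + P * D           ≡⟨ regroup P z D ⟩
  P * ((1ℚ + 1ℚ) * (z * D) + D)           ≡⟨ cong (λ y → P * ((1ℚ + 1ℚ) * y + D)) zd≡a ⟩
  P * (fromℤ (+ 2) * fromℤ a + D)         ≡⟨ cong (λ y → P * (y + D)) (fromℤ-homo-* (+ 2) a) ⟨
  P * (fromℤ (+ 2 ℤ.* a) + fromℤ (+ d))   ≡⟨ cong (P *_) (fromℤ-homo-+ (+ 2 ℤ.* a) (+ d)) ⟨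
  P * fromℤ v                             ≡⟨ fromℤ-homo-* (+ (2 ^ K)) v ⟨
  fromℤ (+ (2 ^ K) ℤ.* v)                 ∎)
  where
  open ≡-Reasoning
  v : ℤ
  v = + 2 ℤ.* a ℤ.+ + d
  P D : ℚ
  P = fromℕ (2 ^ K)
  D = fromℕ d
  split : ∀ x P D → x * D ≡ (x - P) * D + P * D
  split = solve-∀ ℚ-ring
  regroup : ∀ P z D → (1ℚ + 1ℚ) * P * z * D + P * D ≡ P * ((1ℚ + 1ℚ) * (z * D) + D)
  regroup = solve-∀ ℚ-ring
  2∤v : 2 ∤ ∣ v ∣
  2∤v 2∣v = 2∤d (ℤ∣.∣⇒∣ᵤ (ℤ∣.∣m+n∣m⇒∣n (ℤ∣.∣ᵤ⇒∣ {+ 2} 2∣v) (ℤ∣.∣m⇒∣m*n a (ℤ∣.∣-refl {+ 2}))))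

-- Finite sums and the pairing S n = n T n

∑ : ℕ → (ℕ → ℚ) → ℚ
∑ zero    f = 0ℚ
∑ (suc n) f = ∑ n f + f n

∑-cong : ∀ n {f g : ℕ → ℚ} → (∀ j → j < n → f j ≡ g j) → ∑ n f ≡ ∑ n g
∑-cong zero    f≡g = refl
∑-cong (suc n) f≡g = cong₂ _+_ (∑-cong n (λ j j<n → f≡g j (ℕ.m<n⇒m<1+n j<n))) (f≡g n ℕ.≤-refl)

∑-split : ∀ m n (f : ℕ → ℚ) → ∑ (m ℕ.+ n) f ≡ ∑ m f + ∑ n (λ i → f (m ℕ.+ i))
∑-split m zero    f = trans (cong (λ k → ∑ k f) (ℕ.+-identityʳ m)) (sym (ℚ.+-identityʳ (∑ m f)))
∑-split m (suc n) f = begin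
  ∑ (m ℕ.+ suc n) f                                      ≡⟨ cong (λ k → ∑ k f) (ℕ.+-suc m n) ⟩
  ∑ (m ℕ.+ n) f + f (m ℕ.+ n)                            ≡⟨ cong (_+ f (m ℕ.+ n)) (∑-split m n f) ⟩
  (∑ m f + ∑ n (λ i → f (m ℕ.+ i))) + f (m ℕ.+ n)        ≡⟨ ℚ.+-assoc (∑ m f) _ _ ⟩
  ∑ m f + (∑ n (λ i → f (m ℕ.+ i)) + f (m ℕ.+ n))        ∎
  where open ≡-Reasoning

∑-reverse : ∀ n (f : ℕ → ℚ) → ∑ n (λ j → f (n ℕ.∸ suc j)) ≡ ∑ n f
∑-reverse zero    f = refl
∑-reverse (suc n) f = begin
  ∑ (1 ℕ.+ n) (λ j → f (n ℕ.∸ j))          ≡⟨ ∑-split 1 n (λ j → f (n ℕ.∸ j)) ⟩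
  (0ℚ + f n) + ∑ n (λ j → f (n ℕ.∸ suc j)) ≡⟨ cong₂ _+_ (ℚ.+-identityˡ (f n)) (∑-reverse n f) ⟩
  f n + ∑ n f                              ≡⟨ ℚ.+-comm (f n) (∑ n f) ⟩
  ∑ (suc n) f                              ∎
  where open ≡-Reasoning

∑-distrib-+ : ∀ n (f g : ℕ → ℚ) → ∑ n (λ j → f j + g j) ≡ ∑ n f + ∑ n g
∑-distrib-+ zero    f g = refl
∑-distrib-+ (suc n) f g = trans (cong (_+ (f n + g n)) (∑-distrib-+ n f g)) (interchange (∑ n f) (∑ n g) (f n) (g n))
  where
  interchange : ∀ a b c d → (a + b) + (c + d) ≡ (a + c) + (b + d)
  interchange = solve-∀ ℚ-ring

*-distribˡ-∑ : ∀ c n (f : ℕ → ℚ) → c * ∑ n f ≡ ∑ n (λ j → c * f j)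
*-distribˡ-∑ c zero    f = ℚ.*-zeroʳ c
*-distribˡ-∑ c (suc n) f = trans (ℚ.*-distribˡ-+ c (∑ n f) (f n)) (cong (_+ c * f n) (*-distribˡ-∑ c n f))

∑-neg : ∀ n (f : ℕ → ℚ) → ∑ n (λ j → - f j) ≡ - ∑ n f
∑-neg zero    f = refl
∑-neg (suc n) f = trans (cong (_+ - f n) (∑-neg n f)) (sym (ℚ.neg-distrib-+ (∑ n f) (f n)))

∑-≡mod : ∀ {r} n {f g : ℕ → ℚ} → (∀ j → j < n → f j ≡ g j [mod2^ r ]) → ∑ n f ≡ ∑ n g [mod2^ r ]
∑-≡mod zero    f≡g = ≡mod-refl
∑-≡mod (suc n) f≡g = ≡mod-+ (∑-≡mod n (λ j j<n → f≡g j (ℕ.m<n⇒m<1+n j<n))) (f≡g n ℕ.≤-refl)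

S≡∑1/odd : ∀ n → S n ≡ ∑ n 1/odd
S≡∑1/odd zero    = refl
S≡∑1/odd (suc n) = cong (_+ 1/odd n) (S≡∑1/odd n)

sum-of-inverses : ∀ w u w′ u′ → w * u ≡ 1ℚ → w′ * u′ ≡ 1ℚ → w + w′ ≡ (u + u′) * (w * w′)
sum-of-inverses w u w′ u′ wu≡1 w′u′≡1 = begin
  w + w′                        ≡⟨ cong₂ _+_ (ℚ.*-identityʳ w) (ℚ.*-identityʳ w′) ⟨
  w * 1ℚ + w′ * 1ℚ              ≡⟨ cong₂ (λ a b → w * a + w′ * b) w′u′≡1 wu≡1 ⟨
  w * (w′ * u′) + w′ * (w * u)  ≡⟨ rearrange w u w′ u′ ⟩
  (u + u′) * (w * w′)           ∎
  where
  open ≡-Reasoning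
  rearrange : ∀ w u w′ u′ → w * (w′ * u′) + w′ * (w * u) ≡ (u + u′) * (w * w′)
  rearrange = solve-∀ ℚ-ring

difference-of-inverses : ∀ w u w′ u′ → w * u ≡ 1ℚ → w′ * u′ ≡ 1ℚ → w - w′ ≡ (u′ - u) * (w * w′)
difference-of-inverses w u w′ u′ wu≡1 w′u′≡1 = begin
  w - w′                        ≡⟨ cong₂ _-_ (ℚ.*-identityʳ w) (ℚ.*-identityʳ w′) ⟨
  w * 1ℚ - w′ * 1ℚ              ≡⟨ cong₂ (λ a b → w * a - w′ * b) w′u′≡1 wu≡1 ⟨
  w * (w′ * u′) - w′ * (w * u)  ≡⟨ rearrange w u w′ u′ ⟩
  (u′ - u) * (w * w′)           ∎
  where
  open ≡-Reasoning
  rearrange : ∀ w u w′ u′ → w * (w′ * u′) - w′ * (w * u) ≡ (u′ - u) * (w * w′)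
  rearrange = solve-∀ ℚ-ring

difference-of-inverse-squares : ∀ w u w′ u′ → w * u ≡ 1ℚ → w′ * u′ ≡ 1ℚ →
                                w′ * w′ - w * w ≡ (u - u′) * (u + u′) * (w′ * w * (w′ * w))
difference-of-inverse-squares w u w′ u′ wu≡1 w′u′≡1 = begin
  w′ * w′ - w * w                                ≡⟨ difference-of-squares w′ w ⟩
  (w′ - w) * (w′ + w)                            ≡⟨ cong₂ _*_ (difference-of-inverses w′ u′ w u w′u′≡1 wu≡1)
                                                              (sum-of-inverses w′ u′ w u w′u′≡1 wu≡1) ⟩
  (u - u′) * (w′ * w) * ((u′ + u) * (w′ * w))    ≡⟨ regroup u u′ (w′ * w) ⟩
  (u - u′) * (u + u′) * (w′ * w * (w′ * w))      ∎
  where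
  open ≡-Reasoning
  difference-of-squares : ∀ a b → a * a - b * b ≡ (a - b) * (a + b)
  difference-of-squares = solve-∀ ℚ-ring
  regroup : ∀ u u′ v → (u - u′) * v * ((u′ + u) * v) ≡ (u - u′) * (u + u′) * (v * v)
  regroup = solve-∀ ℚ-ring

1/odd-+-1/odd : ∀ j j′ {n} → suc (j ℕ.+ j′) ≡ n →
                1/odd j + 1/odd j′ ≡ fromℕ (2 ℕ.* n) * (1/odd j * 1/odd j′)
1/odd-+-1/odd j j′ {n} j+j′+1≡n = begin
  1/odd j + 1/odd j′
    ≡⟨ sum-of-inverses (1/odd j) u (1/odd j′) u′ (1/odd-inverse j) (1/odd-inverse j′) ⟩
  (u + u′) * (1/odd j * 1/odd j′)
    ≡⟨ cong (_* (1/odd j * 1/odd j′)) u+u′≡2n ⟩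
  fromℕ (2 ℕ.* n) * (1/odd j * 1/odd j′)
    ∎
  where
  open ≡-Reasoning
  u u′ : ℚ
  u = fromℕ (suc (2 ℕ.* j))
  u′ = fromℕ (suc (2 ℕ.* j′))
  odd+odd : ∀ j j′ → suc (2 ℕ.* j) ℕ.+ suc (2 ℕ.* j′) ≡ 2 ℕ.* suc (j ℕ.+ j′)
  odd+odd = ℕ-Solver.solve-∀
  u+u′≡2n : u + u′ ≡ fromℕ (2 ℕ.* n)
  u+u′≡2n = trans (sym (fromℕ-homo-+ (suc (2 ℕ.* j)) (suc (2 ℕ.* j′))))
                  (cong fromℕ (trans (odd+odd j j′) (cong (2 ℕ.*_) j+j′+1≡n)))

T : ℕ → ℚ
T n = ∑ n (λ j → 1/odd j * 1/odd (n ℕ.∸ suc j))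

S+S≡2n*T : ∀ n → S n + S n ≡ fromℕ (2 ℕ.* n) * T n
S+S≡2n*T n = begin
  S n + S n
    ≡⟨ cong₂ _+_ (S≡∑1/odd n) (trans (S≡∑1/odd n) (sym (∑-reverse n 1/odd))) ⟩
  ∑ n 1/odd + ∑ n (λ j → 1/odd (n ℕ.∸ suc j))
    ≡⟨ ∑-distrib-+ n 1/odd (λ j → 1/odd (n ℕ.∸ suc j)) ⟨
  ∑ n (λ j → 1/odd j + 1/odd (n ℕ.∸ suc j))
    ≡⟨ ∑-cong n (λ j j<n → 1/odd-+-1/odd j (n ℕ.∸ suc j) (ℕ.m+[n∸m]≡n j<n)) ⟩
  ∑ n (λ j → fromℕ (2 ℕ.* n) * (1/odd j * 1/odd (n ℕ.∸ suc j)))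
    ≡⟨ *-distribˡ-∑ (fromℕ (2 ℕ.* n)) n _ ⟨
  fromℕ (2 ℕ.* n) * T n
    ∎
  where open ≡-Reasoning

S≡n*T : ∀ n → S n ≡ fromℕ n * T n
S≡n*T n = begin
  S n                              ≡⟨ half (S n) ⟩
  ½ * (S n + S n)                  ≡⟨ cong (½ *_) (S+S≡2n*T n) ⟩
  ½ * (fromℕ (2 ℕ.* n) * T n)     ≡⟨ cong (λ t → ½ * (t * T n)) (fromℕ-homo-* 2 n) ⟩
  ½ * ((1ℚ + 1ℚ) * fromℕ n * T n)  ≡⟨ cancel (fromℕ n) (T n) ⟩
  fromℕ n * T n                    ∎
  where
  open ≡-Reasoning
  half : ∀ x → x ≡ ½ * (x + x)
  half = solve-∀ ℚ-ring
  cancel : ∀ m t → ½ * ((1ℚ + 1ℚ) * m * t) ≡ m * t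
  cancel = solve-∀ ℚ-ring

-- 2-adic estimates

1/odd² : ℕ → ℚ
1/odd² j = 1/odd j * 1/odd j

1/odd²-shift : ∀ s j t → 1/odd² (j ℕ.+ 2 ^ s ℕ.* t) ≡ 1/odd² j [mod2^ 2 ℕ.+ s ]
1/odd²-shift s j t = congruent (- (fromℕ N * (w′ * w * (w′ * w)))) quotient-integral (begin
  w′ * w′ - w * w
    ≡⟨ difference-of-inverse-squares w u w′ u′ (1/odd-inverse j) (1/odd-inverse j′) ⟩
  (u - u′) * (u + u′) * (w′ * w * (w′ * w))
    ≡⟨ cong (_* (w′ * w * (w′ * w))) u²-u′²≡ ⟩
  fromℕ (2 ^ (2 ℕ.+ s)) * - fromℕ N * (w′ * w * (w′ * w))
    ≡⟨ regroup (fromℕ (2 ^ (2 ℕ.+ s))) (fromℕ N) (w′ * w * (w′ * w)) ⟩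
  fromℕ (2 ^ (2 ℕ.+ s)) * - (fromℕ N * (w′ * w * (w′ * w)))
    ∎)
  where
  open ≡-Reasoning
  j′ : ℕ
  j′ = j ℕ.+ 2 ^ s ℕ.* t
  N : ℕ
  N = t ℕ.* (suc (2 ℕ.* j) ℕ.+ 2 ^ s ℕ.* t)
  w w′ u u′ P t′ : ℚ
  w = 1/odd j
  w′ = 1/odd j′
  u = fromℕ (suc (2 ℕ.* j))
  u′ = fromℕ (suc (2 ℕ.* j′))
  P = fromℕ (2 ^ s)
  t′ = fromℕ t
  odd-shift : ∀ j p t → suc (2 ℕ.* (j ℕ.+ p ℕ.* t)) ≡ suc (2 ℕ.* j) ℕ.+ 2 ℕ.* (p ℕ.* t)
  odd-shift = ℕ-Solver.solve-∀
  u′≡ : u′ ≡ u + (1ℚ + 1ℚ) * (P * t′)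
  u′≡ = begin
    u′                                             ≡⟨ cong fromℕ (odd-shift j (2 ^ s) t) ⟩
    fromℕ (suc (2 ℕ.* j) ℕ.+ 2 ℕ.* (2 ^ s ℕ.* t))  ≡⟨ fromℕ-homo-+ (suc (2 ℕ.* j)) (2 ℕ.* (2 ^ s ℕ.* t)) ⟩
    u + fromℕ (2 ℕ.* (2 ^ s ℕ.* t))                ≡⟨ cong (λ a → u + a) (fromℕ-homo-* 2 (2 ^ s ℕ.* t)) ⟩
    u + fromℕ 2 * fromℕ (2 ^ s ℕ.* t)              ≡⟨ cong (λ a → u + fromℕ 2 * a) (fromℕ-homo-* (2 ^ s) t) ⟩
    u + (1ℚ + 1ℚ) * (P * t′)                       ∎
  4P≡ : fromℕ (2 ^ (2 ℕ.+ s)) ≡ (1ℚ + 1ℚ) * ((1ℚ + 1ℚ) * P)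
  4P≡ = trans (fromℕ-homo-* 2 (2 ℕ.* 2 ^ s)) (cong (fromℕ 2 *_) (fromℕ-homo-* 2 (2 ^ s)))
  N≡ : fromℕ N ≡ t′ * (u + P * t′)
  N≡ = begin
    fromℕ N                                        ≡⟨ fromℕ-homo-* t (suc (2 ℕ.* j) ℕ.+ 2 ^ s ℕ.* t) ⟩
    t′ * fromℕ (suc (2 ℕ.* j) ℕ.+ 2 ^ s ℕ.* t)     ≡⟨ cong (t′ *_) (fromℕ-homo-+ (suc (2 ℕ.* j)) (2 ^ s ℕ.* t)) ⟩
    t′ * (u + fromℕ (2 ^ s ℕ.* t))                 ≡⟨ cong (λ a → t′ * (u + a)) (fromℕ-homo-* (2 ^ s) t) ⟩
    t′ * (u + P * t′)                              ∎
  expand : ∀ u P t′ → (u - (u + (1ℚ + 1ℚ) * (P * t′))) * (u + (u + (1ℚ + 1ℚ) * (P * t′)))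
                      ≡ (1ℚ + 1ℚ) * ((1ℚ + 1ℚ) * P) * - (t′ * (u + P * t′))
  expand = solve-∀ ℚ-ring
  u²-u′²≡ : (u - u′) * (u + u′) ≡ fromℕ (2 ^ (2 ℕ.+ s)) * - fromℕ N
  u²-u′²≡ = begin
    (u - u′) * (u + u′)                                                     ≡⟨ cong (λ v → (u - v) * (u + v)) u′≡ ⟩
    (u - (u + (1ℚ + 1ℚ) * (P * t′))) * (u + (u + (1ℚ + 1ℚ) * (P * t′)))     ≡⟨ expand u P t′ ⟩
    (1ℚ + 1ℚ) * ((1ℚ + 1ℚ) * P) * - (t′ * (u + P * t′))                     ≡⟨ cong₂ (λ a b → a * - b) 4P≡ N≡ ⟨
    fromℕ (2 ^ (2 ℕ.+ s)) * - fromℕ N                                       ∎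
  regroup : ∀ a b c → a * - b * c ≡ a * - (b * c)
  regroup = solve-∀ ℚ-ring
  w′w∈ : Integral₂ (w′ * w)
  w′w∈ = Integral₂-* (Integral₂-1/odd j′) (Integral₂-1/odd j)
  quotient-integral : Integral₂ (- (fromℕ N * (w′ * w * (w′ * w))))
  quotient-integral = Integral₂-neg (Integral₂-* (Integral₂-fromℤ (+ N)) (Integral₂-* w′w∈ w′w∈))

∑[2^k]1/odd²≡2^k : ∀ k c → ∑ (2 ^ k) (λ i → 1/odd² (c ℕ.+ i)) ≡ fromℕ (2 ^ k) [mod2^ suc k ]
∑[2^k]1/odd²≡2^k zero c = begin
  0ℚ + 1/odd² (c ℕ.+ 0)  ≡⟨ ℚ.+-identityˡ (1/odd² (c ℕ.+ 0)) ⟩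
  1/odd² (c ℕ.+ 0)       ≈⟨ ≡mod-weaken (1/odd²-shift 0 0 c) ⟩
  1ℚ                     ∎
  where open ≡mod-Reasoning 1
∑[2^k]1/odd²≡2^k (suc k) c = begin
  ∑ (2 ^ suc k) f                  ≡⟨ cong (λ n → ∑ n f) 2^[1+k]≡ ⟩
  ∑ (K ℕ.+ K) f                    ≡⟨ ∑-split K K f ⟩
  ∑ K f + ∑ K (λ i → f (K ℕ.+ i))  ≈⟨ ≡mod-+ (≡mod-refl {x = ∑ K f}) (∑-≡mod K (λ i _ → shift i)) ⟩
  ∑ K f + ∑ K f                    ≡⟨ double (∑ K f) ⟩
  fromℕ 2 * ∑ K f                  ≈⟨ ≡mod-2^*ˡ 1 (∑[2^k]1/odd²≡2^k k c) ⟩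
  fromℕ 2 * fromℕ K                ≡⟨ fromℕ-homo-* 2 K ⟨
  fromℕ (2 ^ suc k)                ∎
  where
  open ≡mod-Reasoning (2 ℕ.+ k)
  K : ℕ
  K = 2 ^ k
  f : ℕ → ℚ
  f i = 1/odd² (c ℕ.+ i)
  2^[1+k]≡ : 2 ^ suc k ≡ K ℕ.+ K
  2^[1+k]≡ = cong (K ℕ.+_) (ℕ.+-identityʳ K)
  double : ∀ x → x + x ≡ (1ℚ + 1ℚ) * x
  double = solve-∀ ℚ-ring
  reindex : ∀ c K i → c ℕ.+ (K ℕ.+ i) ≡ c ℕ.+ i ℕ.+ K ℕ.* 1
  reindex = ℕ-Solver.solve-∀
  shift : ∀ i → f (K ℕ.+ i) ≡ f i [mod2^ 2 ℕ.+ k ]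
  shift i = subst (λ j → 1/odd² j ≡ f i [mod2^ 2 ℕ.+ k ]) (sym (reindex c K i)) (1/odd²-shift k (c ℕ.+ i) 1)

∑[2^k*m]1/odd²≡2^k*m : ∀ k m c →
                       ∑ (2 ^ k ℕ.* m) (λ i → 1/odd² (c ℕ.+ i)) ≡ fromℕ (2 ^ k ℕ.* m) [mod2^ suc k ]
∑[2^k*m]1/odd²≡2^k*m k zero c rewrite ℕ.*-zeroʳ (2 ^ k) = ≡mod-refl
∑[2^k*m]1/odd²≡2^k*m k (suc m) c = begin
  ∑ (K ℕ.* suc m) f
    ≡⟨ cong (λ n → ∑ n f) (ℕ.*-suc K m) ⟩
  ∑ (K ℕ.+ K ℕ.* m) f
    ≡⟨ ∑-split K (K ℕ.* m) f ⟩
  ∑ K f + ∑ (K ℕ.* m) (λ i → f (K ℕ.+ i))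
    ≡⟨ cong (λ a → ∑ K f + a) (∑-cong (K ℕ.* m) (λ i _ → cong 1/odd² (ℕ.+-assoc c K i))) ⟨
  ∑ K f + ∑ (K ℕ.* m) (λ i → 1/odd² (c ℕ.+ K ℕ.+ i))
    ≈⟨ ≡mod-+ (∑[2^k]1/odd²≡2^k k c) (∑[2^k*m]1/odd²≡2^k*m k m (c ℕ.+ K)) ⟩
  fromℕ K + fromℕ (K ℕ.* m)
    ≡⟨ fromℕ-homo-+ K (K ℕ.* m) ⟨
  fromℕ (K ℕ.+ K ℕ.* m)
    ≡⟨ cong fromℕ (ℕ.*-suc K m) ⟨
  fromℕ (K ℕ.* suc m)
    ∎
  where
  open ≡mod-Reasoning (suc k)
  K : ℕ
  K = 2 ^ k
  f : ℕ → ℚ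
  f i = 1/odd² (c ℕ.+ i)

2^k*odd≡2^k : ∀ k {m} → 2 ∤ m → fromℕ (2 ^ k ℕ.* m) ≡ fromℕ (2 ^ k) [mod2^ suc k ]
2^k*odd≡2^k k {m} 2∤m with 2∤⇒1+2* 2∤m
... | t , refl = congruent (fromℕ t) (Integral₂-fromℤ (+ t)) (begin
  fromℕ (2 ^ k ℕ.* suc (2 ℕ.* t)) - P                   ≡⟨ cong (_- P) (fromℕ-homo-* (2 ^ k) (suc (2 ℕ.* t))) ⟩
  P * fromℕ (1 ℕ.+ 2 ℕ.* t) - P                         ≡⟨ cong (λ a → P * a - P) (fromℕ-homo-+ 1 (2 ℕ.* t)) ⟩
  P * (1ℚ + fromℕ (2 ℕ.* t)) - P                        ≡⟨ cong (λ a → P * (1ℚ + a) - P) (fromℕ-homo-* 2 t) ⟩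
  P * (1ℚ + (1ℚ + 1ℚ) * fromℕ t) - P                    ≡⟨ cancel P (fromℕ t) ⟩
  (1ℚ + 1ℚ) * P * fromℕ t                               ≡⟨ cong (_* fromℕ t) (fromℕ-homo-* 2 (2 ^ k)) ⟨
  fromℕ (2 ^ suc k) * fromℕ t                           ∎)
  where
  open ≡-Reasoning
  P : ℚ
  P = fromℕ (2 ^ k)
  cancel : ∀ P t → P * (1ℚ + (1ℚ + 1ℚ) * t) - P ≡ (1ℚ + 1ℚ) * P * t
  cancel = solve-∀ ℚ-ring

-2^k≡2^k : ∀ k → - fromℕ (2 ^ k) ≡ fromℕ (2 ^ k) [mod2^ suc k ]
-2^k≡2^k k = congruent (- 1ℚ) (Integral₂-neg (Integral₂-fromℤ (+ 1))) (begin
  - P - P                  ≡⟨ negate P ⟩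
  (1ℚ + 1ℚ) * P * - 1ℚ     ≡⟨ cong (_* - 1ℚ) (fromℕ-homo-* 2 (2 ^ k)) ⟨
  fromℕ (2 ^ suc k) * - 1ℚ ∎)
  where
  open ≡-Reasoning
  P : ℚ
  P = fromℕ (2 ^ k)
  negate : ∀ P → - P - P ≡ (1ℚ + 1ℚ) * P * - 1ℚ
  negate = solve-∀ ℚ-ring

1/odd*1/odd≡-1/odd² : ∀ k m j j′ → suc (j ℕ.+ j′) ≡ 2 ^ k ℕ.* m →
                      1/odd j * 1/odd j′ ≡ - 1/odd² j [mod2^ suc k ]
1/odd*1/odd≡-1/odd² k m j j′ j+j′+1≡n = congruent (fromℕ m * (w * (w′ * w))) quotient-integral (begin
  w * w′ - - (w * w)
    ≡⟨ factor w w′ ⟩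
  w * (w′ + w)
    ≡⟨ cong (w *_) (1/odd-+-1/odd j′ j (trans (cong suc (ℕ.+-comm j′ j)) j+j′+1≡n)) ⟩
  w * (fromℕ (2 ℕ.* (2 ^ k ℕ.* m)) * (w′ * w))
    ≡⟨ cong (λ a → w * (fromℕ a * (w′ * w))) (ℕ.*-assoc 2 (2 ^ k) m) ⟨
  w * (fromℕ (2 ^ suc k ℕ.* m) * (w′ * w))
    ≡⟨ cong (λ a → w * (a * (w′ * w))) (fromℕ-homo-* (2 ^ suc k) m) ⟩
  w * (fromℕ (2 ^ suc k) * fromℕ m * (w′ * w))
    ≡⟨ regroup w (fromℕ (2 ^ suc k)) (fromℕ m) (w′ * w) ⟩
  fromℕ (2 ^ suc k) * (fromℕ m * (w * (w′ * w)))
    ∎)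
  where
  open ≡-Reasoning
  w w′ : ℚ
  w = 1/odd j
  w′ = 1/odd j′
  factor : ∀ w w′ → w * w′ - - (w * w) ≡ w * (w′ + w)
  factor = solve-∀ ℚ-ring
  regroup : ∀ w p m v → w * (p * m * v) ≡ p * (m * (w * v))
  regroup = solve-∀ ℚ-ring
  quotient-integral : Integral₂ (fromℕ m * (w * (w′ * w)))
  quotient-integral = Integral₂-* (Integral₂-fromℤ (+ m))
    (Integral₂-* (Integral₂-1/odd j) (Integral₂-* (Integral₂-1/odd j′) (Integral₂-1/odd j)))

T[2^k*odd]≡2^k : ∀ k {m} → 2 ∤ m → T (2 ^ k ℕ.* m) ≡ fromℕ (2 ^ k) [mod2^ suc k ]
T[2^k*odd]≡2^k k {m} 2∤m = begin
  T n                          ≈⟨ ∑-≡mod n (λ j j<n → 1/odd*1/odd≡-1/odd² k m j (n ℕ.∸ suc j) (ℕ.m+[n∸m]≡n j<n)) ⟩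
  ∑ n (λ j → - 1/odd² j)       ≡⟨ ∑-neg n 1/odd² ⟩
  - ∑ n 1/odd²                 ≈⟨ ≡mod-neg (∑[2^k*m]1/odd²≡2^k*m k m 0) ⟩
  - fromℕ n                    ≈⟨ ≡mod-neg (2^k*odd≡2^k k 2∤m) ⟩
  - fromℕ (2 ^ k)              ≈⟨ -2^k≡2^k k ⟩
  fromℕ (2 ^ k)                ∎
  where
  open ≡mod-Reasoning (suc k)
  n : ℕ
  n = 2 ^ k ℕ.* m

S[2^k*odd]≡2^[k+k] : ∀ k {m} → 2 ∤ m → S (2 ^ k ℕ.* m) ≡ fromℕ (2 ^ (k ℕ.+ k)) [mod2^ suc (k ℕ.+ k) ]
S[2^k*odd]≡2^[k+k] k {m} 2∤m = subst (λ r → S n ≡ fromℕ (2 ^ (k ℕ.+ k)) [mod2^ r ]) (ℕ.+-suc k k) (begin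
  S n                              ≡⟨ S≡n*T n ⟩
  fromℕ n * T n                    ≡⟨ cong (_* T n) (fromℕ-homo-* (2 ^ k) m) ⟩
  fromℕ (2 ^ k) * fromℕ m * T n    ≡⟨ ℚ.*-assoc (fromℕ (2 ^ k)) (fromℕ m) (T n) ⟩
  fromℕ (2 ^ k) * (fromℕ m * T n)  ≈⟨ ≡mod-2^*ˡ k m*T≡2^k ⟩
  fromℕ (2 ^ k) * fromℕ (2 ^ k)    ≡⟨ fromℕ-homo-* (2 ^ k) (2 ^ k) ⟨
  fromℕ (2 ^ k ℕ.* 2 ^ k)          ≡⟨ cong fromℕ (ℕ.^-distribˡ-+-* 2 k k) ⟨
  fromℕ (2 ^ (k ℕ.+ k))            ∎)
  where
  open ≡mod-Reasoning (k ℕ.+ suc k)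
  n : ℕ
  n = 2 ^ k ℕ.* m
  m*T≡2^k : fromℕ m * T n ≡ fromℕ (2 ^ k) [mod2^ suc k ]
  m*T≡2^k = ≡mod-trans (≡mod-*ˡ (Integral₂-fromℤ (+ m)) (T[2^k*odd]≡2^k k 2∤m))
    (subst (_≡ fromℕ (2 ^ k) [mod2^ suc k ]) (trans (cong fromℕ (ℕ.*-comm (2 ^ k) m)) (fromℕ-homo-* m (2 ^ k)))
      (2^k*odd≡2^k k 2∤m))

proposition4p1 : ∀ (n : ℕ) → 1 ℕ.≤ n → ν₂ (S n) ≡ + (2 ℕ.* ν₂ℕ n)
proposition4p1 n 1≤n with ν₂ℕ-decomposition n {{ℕ.>-nonZero 1≤n}}
... | m , 2∤m , n≡2^k*m = begin
  ν₂ (S n)                ≡⟨ cong (λ n → ν₂ (S n)) n≡2^k*m ⟩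
  ν₂ (S (2 ^ k ℕ.* m))    ≡⟨ x≡2^K⇒ν₂x≡K (k ℕ.+ k) (S[2^k*odd]≡2^[k+k] k 2∤m) ⟩
  + (k ℕ.+ k)             ≡⟨ cong (λ j → + (k ℕ.+ j)) (ℕ.+-identityʳ k) ⟨
  + (2 ℕ.* k)             ∎
  where
  open ≡-Reasoning
  k : ℕ
  k = ν₂ℕ n
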